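{- Let $A$ be a circular $m\times n$ matrix, $\alpha\in\mathbb{N}$ and $x^*\in Q(A,\alpha\mathbf1)$. Then for every $i\in[m]$, in $D(A,x^*)$: (i) $c^+_i(x^*)-c^+(P_i^+,x^*)=-\mu\alpha$; (ii) $c^-_i(x^*)-c^-(P_i^-,x^*)=-(1-\mu)\alpha$.
   Context: $[n]=\{1,\dots,n\}$ with addition mod $n$ (node $0$ identified with $n$); $[a,c)_n$ is the cyclic interval $\{a,\dots,c-1\}$ mod $n$. A $\{0,1\}$ $m\times n$ matrix $A$ is circular if each row $i$ is the incidence vector of $[\ell_i,\ell_i+k_i)_n$, $2\le k_i\le n-1$. $Q(A,b)=\{x\ge0:Ax\ge b\}$. $D(A)$: node set $[n]$; forward arcs $a_i=(\ell_i-1,\ell_i+k_i-1)$, $i\in[m]$, $a_{m+j}=(j-1,j)$, $j\in[n]$; reverse arcs $\bar a_i=(\ell_i+k_i-1,\ell_i-1)$, $\bar a_{m+j}=(j,j-1)$. For $i\in[m]$, $P_i^+$ is the path of forward short arcs from $\ell_i-1$ to $\ell_i+k_i-1$, and $P_i^-$ the path of reverse short arcs from $\ell_i+k_i-1$ to $\ell_i-1$. Costs: with $b=\alpha\mathbf1$, $\tilde A=\binom{A}{I}$, $d=\binom b0$, $v$ the last column of $\tilde A$, $s^*=\tilde Ax^*-d$, $\mu=\lceil\mathbf1^Tx^*\rceil-\mathbf1^Tx^*$, $c^+(x^*)=\mu(s^*-(1-\mu)v)$, $c^-(x^*)=(1-\mu)(s^*+\mu v)$; in $D(A,x^*)$ arc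 $a_k$ costs $c^+_k(x^*)$ and $\bar a_k$ costs $c^-_k(x^*)$, $k\in[m+n]$; $c^\pm(P,x^*)$ is the sum of arc costs along a path $P$. -}

module Defs where

open import Level using (Level)
open import Algebra.Bundles using (CommutativeRing)
open import Data.Bool using (Bool; true; false; if_then_else_)
open import Data.Nat using (ℕ; zero; suc; NonZero) renaming (_+_ to _+ℕ_; _∸_ to _∸ℕ_; _≤_ to _≤ℕ_)
open import Data.Nat.DivMod using (_mod_)
open import Data.Fin using (Fin) renaming (zero to fzero; suc to fsuc)
import Data.Fin as Fin
open import Data.List using (List; map; reverse; foldr; upTo)
open import Data.Bool.ListAction using (any)
open import Data.Product using (_×_)
open import Relation.Nullary.Decidable using (⌊_⌋)

-- Elements of [n] = {1,…,n} are represented by Fin n, the index f standing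
-- for the element toℕ f + 1.  `elem n a` is the element of [n] congruent to
-- the natural number a modulo n (so node 0 is identified with n).
elem : (n : ℕ) .{{_ : NonZero n}} → ℕ → Fin n
elem n a = (a +ℕ (n ∸ℕ 1)) mod n

-- A circular m×n matrix, given by its rows: row i is the incidence vector of
-- the cyclic interval [ℓ i , ℓ i + k i)_n with 1 ≤ ℓ i ≤ n and 2 ≤ k i ≤ n-1.
record Circular (m n : ℕ) : Set where
  field
    ℓ : Fin m → ℕ
    k : Fin m → ℕ
    ℓ-range : ∀ i → 1 ≤ℕ ℓ i × ℓ i ≤ℕ n
    k-range : ∀ i → 2 ≤ℕ k i × k i ≤ℕ n ∸ℕ 1

inInterval : (n : ℕ) .{{_ : NonZero n}} → ℕ → ℕ → Fin n → Bool
inInterval n a len j = any (λ t → ⌊ elem n (a +ℕ t) Fin.≟ j ⌋) (upTo len)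

entry : ∀ {m n} .{{_ : NonZero n}} → Circular m n → Fin m → Fin n → Bool
entry {n = n} A i j = inInterval n (Circular.ℓ A i) (Circular.k A i) j

module RingDefs {c ℓr : Level} (R : CommutativeRing c ℓr) where
  open CommutativeRing R

  Σ : ∀ {n} → (Fin n → Carrier) → Carrier
  Σ {zero} f = 0#
  Σ {suc n} f = f fzero + Σ (λ j → f (fsuc j))

  sumL : List Carrier → Carrier
  sumL = foldr _+_ 0#

  ι : ℕ → Carrier
  ι zero = 0#
  ι (suc a) = 1# + ι a

  𝟙 : Bool → Carrier
  𝟙 b = if b then 1# else 0#

  module Costs {m n : ℕ} .{{_ : NonZero n}} (A : Circular m n) (α : ℕ)
               (ceil : Carrier → Carrier) (x : Fin n → Carrier) where
    open Circular A

    Aent : Fin m → Fin n → Carrier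
    Aent i j = 𝟙 (entry A i j)

    Ax : Fin m → Carrier
    Ax i = Σ (λ j → Aent i j * x j)

    lastCol : Fin n
    lastCol = elem n n

    -- s* = Ã x* − d, split into the first m rows (index i) and the last n rows (index m+j)
    s-row : Fin m → Carrier
    s-row i = Ax i - ι α

    s-short : Fin n → Carrier
    s-short j = x j

    -- v = last column of Ã = (A ; I)
    v-row : Fin m → Carrier
    v-row i = Aent i lastCol

    v-short : Fin n → Carrier
    v-short j = 𝟙 ⌊ j Fin.≟ lastCol ⌋

    total : Carrier
    total = Σ x

    μ : Carrier
    μ = ceil total - total

    -- c⁺(x*) = μ (s* − (1−μ) v), c⁻(x*) = (1−μ)(s* + μ v):
    -- costs of arcs a_i / ā_i (i ∈ [m]) and a_{m+j} / ā_{m+j} (j ∈ [n])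
    c⁺-row : Fin m → Carrier
    c⁺-row i = μ * (s-row i - (1# - μ) * v-row i)

    c⁺-short : Fin n → Carrier
    c⁺-short j = μ * (s-short j - (1# - μ) * v-short j)

    c⁻-row : Fin m → Carrier
    c⁻-row i = (1# - μ) * (s-row i + μ * v-row i)

    c⁻-short : Fin n → Carrier
    c⁻-short j = (1# - μ) * (s-short j + μ * v-short j)

    -- P_i^+: the forward short arcs a_{m+j} = (j-1, j) for
    -- j = ℓ_i, ℓ_i+1, …, ℓ_i+k_i−1 (mod n), in order from ℓ_i − 1 to ℓ_i + k_i − 1
    P⁺ : Fin m → List (Fin n)
    P⁺ i = map (λ t → elem n (ℓ i +ℕ t)) (upTo (k i))

    -- P_i^-: the reverse short arcs ā_{m+j} = (j, j-1) for
    -- j = ℓ_i+k_i−1, …, ℓ_i, in order from ℓ_i + k_i − 1 to ℓ_i − 1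
    P⁻ : Fin m → List (Fin n)
    P⁻ i = reverse (P⁺ i)

    c⁺P : Fin m → Carrier
    c⁺P i = sumL (map c⁺-short (P⁺ i))

    c⁻P : Fin m → Carrier
    c⁻P i = sumL (map c⁻-short (P⁻ i))

    Feasible : ∀ {ℓ'} → (Carrier → Carrier → Set ℓ') → Set _
    Feasible _≤R_ = (∀ j → 0# ≤R x j) × (∀ i → ι α ≤R Ax i)

-- Row i of A is the indicator of the window g(0), …, g(k_i − 1) with
-- g(t) = ℓ_i + t mod n, and these k_i < n nodes are pairwise distinct.  Hence
-- (Ax*)_i and v_i are the sums of x*_j and v_{m+j} along the short arcs of
-- P_i^±, so s*_i is the path sum of the short-arc slacks minus α.  The costs
-- c^± are linear in (s*, v), so the row cost and the path cost differ only by
-- the cost of (−α, 0), which is −μα resp. −(1−μ)α.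
module Submission where

open import Defs
open import Level using (Level)
open import Algebra.Bundles using (CommutativeRing)
open import Data.Nat using (ℕ; zero; suc; NonZero) renaming (_+_ to _+ℕ_)
open import Data.Nat.Properties using (≤-trans; m∸n≤m)
open import Data.Fin using (Fin; zero; suc; _≟_; toℕ; punchIn)
open import Data.Product using (_×_; _,_; proj₂)

open import Data.Bool using (Bool; true; false; T)
open import Data.Bool.ListAction using (any)
open import Data.Empty using (⊥-elim)
open import Data.Fin.Properties using (toℕ-fromℕ<; punchInᵢ≢i)
open import Data.List using (List; []; _∷_; map; reverse; upTo)
open import Data.List.Properties using (map-∘; reverse-map)
open import Data.List.Relation.Unary.All as All using (All; []; _∷_)
open import Data.List.Relation.Unary.AllPairs as AllPairs using (AllPairs; []; _∷_)
open import Data.List.Relation.Unary.AllPairs.Properties using (applyUpTo⁺₁)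
open import Data.Maybe using (nothing)
open import Function using (_∘_; id)
open import Relation.Binary.PropositionalEquality as ≡ using (_≡_; _≢_)
open import Relation.Nullary using (¬_)
open import Relation.Nullary.Decidable using (⌊_⌋; isYes≗does; dec-true; dec-false; toWitness)

module CyclicWindow where

  open import Data.Nat using (_+_; _*_; _∸_; _<_; _≤_; _%_; _/_; >-nonZero)
  open import Data.Nat.DivMod using (m≡m%n+[m/n]*n)
  open import Data.Nat.Divisibility using (_∣_; divides; ∣m+n∣m⇒∣n; n∣m*n; ∣⇒≤)
  open import Data.Nat.Properties
    using (+-assoc; +-cancelˡ-≡; m+[n∸m]≡n; m<n⇒0<n∸m; ≤-<-trans; <-≤-trans; <⇒≤; <⇒≱)
  open import Data.Nat.Tactic.RingSolver using (solve-∀)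

  %-shift-≢ : ∀ n .{{_ : NonZero n}} a {d} → 0 < d → d < n → (a + d) % n ≢ a % n
  %-shift-≢ n a {d} 0<d d<n eq = <⇒≱ d<n (∣⇒≤ {{>-nonZero 0<d}} n∣d)
    where
    open ≡.≡-Reasoning
    quotients : a / n * n + d ≡ (a + d) / n * n
    quotients = +-cancelˡ-≡ (a % n) _ _ (begin
      a % n + (a / n * n + d)        ≡⟨ +-assoc (a % n) _ d ⟨
      a % n + a / n * n + d          ≡⟨ ≡.cong (_+ d) (m≡m%n+[m/n]*n a n) ⟨
      a + d                          ≡⟨ m≡m%n+[m/n]*n (a + d) n ⟩
      (a + d) % n + (a + d) / n * n  ≡⟨ ≡.cong (_+ (a + d) / n * n) eq ⟩
      a % n + (a + d) / n * n        ∎)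
    n∣d : n ∣ d
    n∣d = ∣m+n∣m⇒∣n (divides ((a + d) / n) quotients) (n∣m*n (a / n))

  elem-distinct : ∀ n .{{_ : NonZero n}} l {s t} → s < t → t < n → elem n (l + s) ≢ elem n (l + t)
  elem-distinct n l {s} {t} s<t t<n eq =
    %-shift-≢ n (l + s + w) (m<n⇒0<n∸m s<t) (≤-<-trans (m∸n≤m t s) t<n) (begin
      (l + s + w + (t ∸ s)) % n    ≡⟨ ≡.cong (_% n) (shift l s w (t ∸ s)) ⟩
      (l + (s + (t ∸ s)) + w) % n  ≡⟨ ≡.cong (λ u → (l + u + w) % n) (m+[n∸m]≡n (<⇒≤ s<t)) ⟩
      (l + t + w) % n              ≡⟨ toℕ-fromℕ< _ ⟨
      toℕ (elem n (l + t))         ≡⟨ ≡.cong toℕ eq ⟨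
      toℕ (elem n (l + s))         ≡⟨ toℕ-fromℕ< _ ⟩
      (l + s + w) % n              ∎)
    where
    open ≡.≡-Reasoning
    w = n ∸ 1
    shift : ∀ a b c d → a + b + c + d ≡ a + (b + d) + c
    shift = solve-∀

  window-distinct : ∀ n .{{_ : NonZero n}} l {k} → k ≤ n →
                    AllPairs (λ s t → elem n (l + s) ≢ elem n (l + t)) (upTo k)
  window-distinct n l {k} k≤n = applyUpTo⁺₁ id k (λ s<t t<k → elem-distinct n l s<t (<-≤-trans t<k k≤n))

module RingSums {c ℓr} (R : CommutativeRing c ℓr) where

  open CommutativeRing R hiding (zero)
  open RingDefs R
  open import Algebra.Properties.Semiring.Sum semiring
    using (sum; sum-cong-≋; sum-remove; ∑-distrib-+; sum-replicate-zero)
  open import Algebra.Properties.Ring ring using (-‿distribʳ-*)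
  open import Algebra.Properties.AbelianGroup +-abelianGroup using (xyx⁻¹≈y)
  open import Data.List.Relation.Binary.Permutation.Setoid.Properties setoid
    using (↭-reverse; foldr-commMonoid)
  open import Relation.Binary.Reasoning.Setoid setoid
  open import Tactic.RingSolver.Core.AlmostCommutativeRing using (fromCommutativeRing)
  open import Tactic.RingSolver.NonReflective (fromCommutativeRing R (λ _ → nothing))
    using (solve; _⊕_; _⊗_; _⊜_)

  Σ≡sum : ∀ {n} (f : Fin n → Carrier) → Σ f ≡ sum f
  Σ≡sum {zero} f = ≡.refl
  Σ≡sum {suc n} f = ≡.cong (f zero +_) (Σ≡sum (f ∘ suc))

  sumL-map-cong : ∀ {A : Set} {f g : A → Carrier} ts → (∀ t → f t ≈ g t) →
                  sumL (map f ts) ≈ sumL (map g ts)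
  sumL-map-cong [] f≈g = refl
  sumL-map-cong (t ∷ ts) f≈g = +-cong (f≈g t) (sumL-map-cong ts f≈g)

  sumL-map-zero : ∀ {A : Set} {f : A → Carrier} {ts} → All (λ t → f t ≈ 0#) ts → sumL (map f ts) ≈ 0#
  sumL-map-zero [] = refl
  sumL-map-zero (ft≈0 ∷ fts≈0) = trans (+-cong ft≈0 (sumL-map-zero fts≈0)) (+-identityˡ 0#)

  sumL-reverse : ∀ xs → sumL (reverse xs) ≈ sumL xs
  sumL-reverse xs = foldr-commMonoid +-isCommutativeMonoid (↭-reverse xs)

  sumL-*-distribʳ : ∀ {A : Set} y (f : A → Carrier) ts →
                    sumL (map f ts) * y ≈ sumL (map (λ t → f t * y) ts)
  sumL-*-distribʳ y f [] = zeroˡ y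
  sumL-*-distribʳ y f (t ∷ ts) = trans (distribʳ y (f t) _) (+-congˡ (sumL-*-distribʳ y f ts))

  sumL-map-additive : ∀ {A : Set} (L : Carrier → Carrier → Carrier) → L 0# 0# ≈ 0# →
                      (∀ p q p′ q′ → L (p + p′) (q + q′) ≈ L p q + L p′ q′) →
                      ∀ (f g : A → Carrier) ts →
                      sumL (map (λ t → L (f t) (g t)) ts) ≈ L (sumL (map f ts)) (sumL (map g ts))
  sumL-map-additive L L-zero L-additive f g [] = sym L-zero
  sumL-map-additive L L-zero L-additive f g (t ∷ ts) =
    trans (+-congˡ (sumL-map-additive L L-zero L-additive f g ts)) (sym (L-additive _ _ _ _))

  sum-sumL-comm : ∀ {A : Set} {n} (h : A → Fin n → Carrier) ts →
                  sum (λ j → sumL (map (λ t → h t j) ts)) ≈ sumL (map (λ t → sum (h t)) ts)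
  sum-sumL-comm {n = n} h [] = sum-replicate-zero n
  sum-sumL-comm h (t ∷ ts) =
    trans (∑-distrib-+ (h t) _) (+-congˡ (sum-sumL-comm h ts))

  𝟙-any-disjoint : ∀ {A : Set} (p : A → Bool) ts → AllPairs (λ s t → T (p s) → ¬ T (p t)) ts →
                   𝟙 (any p ts) ≈ sumL (map (𝟙 ∘ p) ts)
  𝟙-any-disjoint p [] [] = refl
  𝟙-any-disjoint p (t ∷ ts) (pt⇒¬p ∷ disjoint) with p t
  ... | true  = sym (trans (+-congˡ (sumL-map-zero (All.map 𝟙-false pt⇒¬p))) (+-identityʳ 1#))
    where
    𝟙-false : ∀ {s} → (T true → ¬ T (p s)) → 𝟙 (p s) ≈ 0#
    𝟙-false {s} ¬ps with p s
    ... | true  = ⊥-elim (¬ps _ _)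
    ... | false = refl
  ... | false = trans (𝟙-any-disjoint p ts disjoint) (sym (+-identityˡ _))

  𝟙-any-≟ : ∀ {A : Set} {n} (g : A → Fin n) ts → AllPairs (λ s t → g s ≢ g t) ts → ∀ c →
            𝟙 (any (λ t → ⌊ g t ≟ c ⌋) ts) ≈ sumL (map (λ t → 𝟙 ⌊ g t ≟ c ⌋) ts)
  𝟙-any-≟ g ts distinct c = 𝟙-any-disjoint (λ t → ⌊ g t ≟ c ⌋) ts (AllPairs.map disjoint distinct)
    where
    disjoint : ∀ {s t} → g s ≢ g t → T ⌊ g s ≟ c ⌋ → ¬ T ⌊ g t ≟ c ⌋
    disjoint gs≢gt gs≡c gt≡c = gs≢gt (≡.trans (toWitness gs≡c) (≡.sym (toWitness gt≡c)))

  𝟙-≟-refl : ∀ {n} (a : Fin n) → 𝟙 ⌊ a ≟ a ⌋ ≈ 1#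
  𝟙-≟-refl a = reflexive (≡.cong 𝟙 (≡.trans (isYes≗does (a ≟ a)) (dec-true (a ≟ a) ≡.refl)))

  𝟙-≟-≢ : ∀ {n} {a b : Fin n} → a ≢ b → 𝟙 ⌊ a ≟ b ⌋ ≈ 0#
  𝟙-≟-≢ {a = a} {b} a≢b = reflexive (≡.cong 𝟙 (≡.trans (isYes≗does (a ≟ b)) (dec-false (a ≟ b) a≢b)))

  sum-δ : ∀ {n} (a : Fin n) (f : Fin n → Carrier) → sum (λ j → 𝟙 ⌊ a ≟ j ⌋ * f j) ≈ f a
  sum-δ {suc n} a f = begin
    sum δf                               ≈⟨ sum-remove {i = a} δf ⟩
    δf a + sum (λ j → δf (punchIn a j))  ≈⟨ +-cong diagonal (sum-cong-≋ {n} off-diagonal) ⟩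
    f a + sum {n} (λ _ → 0#)             ≈⟨ +-congˡ (sum-replicate-zero n) ⟩
    f a + 0#                             ≈⟨ +-identityʳ (f a) ⟩
    f a                                  ∎
    where
    δf : Fin (suc n) → Carrier
    δf j = 𝟙 ⌊ a ≟ j ⌋ * f j
    diagonal : δf a ≈ f a
    diagonal = trans (*-congʳ (𝟙-≟-refl a)) (*-identityˡ (f a))
    off-diagonal : ∀ j → δf (punchIn a j) ≈ 0#
    off-diagonal j = trans (*-congʳ (𝟙-≟-≢ (punchInᵢ≢i a j ∘ ≡.sym))) (zeroˡ _)

  sum-𝟙-image : ∀ {A : Set} {n} (g : A → Fin n) ts → AllPairs (λ s t → g s ≢ g t) ts →
                ∀ (y : Fin n → Carrier) →
                sum (λ j → 𝟙 (any (λ t → ⌊ g t ≟ j ⌋) ts) * y j) ≈ sumL (map (y ∘ g) ts)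
  sum-𝟙-image g ts distinct y = begin
    sum (λ j → 𝟙 (any (λ t → ⌊ g t ≟ j ⌋) ts) * y j)
      ≈⟨ sum-cong-≋ (λ j → *-congʳ (𝟙-any-≟ g ts distinct j)) ⟩
    sum (λ j → sumL (map (λ t → 𝟙 ⌊ g t ≟ j ⌋) ts) * y j)
      ≈⟨ sum-cong-≋ (λ j → sumL-*-distribʳ (y j) (λ t → 𝟙 ⌊ g t ≟ j ⌋) ts) ⟩
    sum (λ j → sumL (map (λ t → 𝟙 ⌊ g t ≟ j ⌋ * y j) ts))
      ≈⟨ sum-sumL-comm (λ t j → 𝟙 ⌊ g t ≟ j ⌋ * y j) ts ⟩
    sumL (map (λ t → sum (λ j → 𝟙 ⌊ g t ≟ j ⌋ * y j)) ts)
      ≈⟨ sumL-map-cong ts (λ t → sum-δ (g t) y) ⟩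
    sumL (map (y ∘ g) ts) ∎

  scaled-shift : ∀ u s b w → u * ((s - b) + w) - u * (s + w) ≈ - (u * b)
  scaled-shift u s b w = begin
    u * ((s - b) + w) - u * (s + w)        ≈⟨ +-congʳ (distrib-split u s (- b) w) ⟩
    u * (s + w) + u * (- b) - u * (s + w)  ≈⟨ xyx⁻¹≈y (u * (s + w)) (u * (- b)) ⟩
    u * (- b)                              ≈⟨ -‿distribʳ-* u b ⟨
    - (u * b)                              ∎
    where
    distrib-split : ∀ u s b w → u * ((s + b) + w) ≈ u * (s + w) + u * b
    distrib-split = solve 4 (λ u s b w → u ⊗ ((s ⊕ b) ⊕ w) ⊜ (u ⊗ (s ⊕ w) ⊕ u ⊗ b)) refl

module RowCosts {c ℓr} (R : CommutativeRing c ℓr) (ceil : CommutativeRing.Carrier R → CommutativeRing.Carrier R)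
                {m n : ℕ} .{{_ : NonZero n}} (A : Circular m n) (α : ℕ)
                (x : Fin n → CommutativeRing.Carrier R) (i : Fin m) where

  open CommutativeRing R hiding (zero)
  open RingDefs R
  open Costs A α ceil x
  open Circular A
  open RingSums R
  open import Algebra.Properties.Ring ring using (-0#≈0#)
  open import Relation.Binary.Reasoning.Setoid setoid
  open import Tactic.RingSolver.Core.AlmostCommutativeRing using (fromCommutativeRing)
  open import Tactic.RingSolver.NonReflective (fromCommutativeRing R (λ _ → nothing))
    using (solve; Expr; _⊕_; _⊗_; ⊝_; _⊜_; Κ)

  window : ℕ → Fin n
  window t = elem n (ℓ i +ℕ t)

  ts : List ℕ
  ts = upTo (k i)

  window-injective : AllPairs (λ s t → window s ≢ window t) ts
  window-injective = CyclicWindow.window-distinct n (ℓ i) (≤-trans (proj₂ (k-range i)) (m∸n≤m n 1))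

  onLast : ℕ → Carrier
  onLast t = 𝟙 ⌊ window t ≟ lastCol ⌋

  X W : Carrier
  X = sumL (map (x ∘ window) ts)
  W = sumL (map onLast ts)

  Ax≈X : Ax i ≈ X
  Ax≈X = trans (reflexive (Σ≡sum {n} _)) (sum-𝟙-image window ts window-injective x)

  v-row≈W : v-row i ≈ W
  v-row≈W = 𝟙-any-≟ window ts window-injective lastCol

  cost⁺ cost⁻ : Carrier → Carrier → Carrier
  cost⁺ s v = μ * (s - (1# - μ) * v)
  cost⁻ s v = (1# - μ) * (s + μ * v)

  Cost⁺ Cost⁻ : ∀ {k} → Expr Carrier k → Expr Carrier k → Expr Carrier k → Expr Carrier k
  Cost⁺ u s v = u ⊗ (s ⊕ (⊝ ((Κ 1# ⊕ (⊝ u)) ⊗ v)))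
  Cost⁻ u s v = (Κ 1# ⊕ (⊝ u)) ⊗ (s ⊕ (u ⊗ v))

  -- Not by the solver: without a zero test it cannot cancel the constant coefficients.
  cost⁺-zero : cost⁺ 0# 0# ≈ 0#
  cost⁺-zero = begin
    μ * (0# - (1# - μ) * 0#)  ≈⟨ *-congˡ (+-congˡ (trans (-‿cong (zeroʳ (1# - μ))) -0#≈0#)) ⟩
    μ * (0# + 0#)             ≈⟨ *-congˡ (+-identityʳ 0#) ⟩
    μ * 0#                    ≈⟨ zeroʳ μ ⟩
    0#                        ∎

  cost⁻-zero : cost⁻ 0# 0# ≈ 0#
  cost⁻-zero = begin
    (1# - μ) * (0# + μ * 0#)  ≈⟨ *-congˡ (+-congˡ (zeroʳ μ)) ⟩
    (1# - μ) * (0# + 0#)      ≈⟨ *-congˡ (+-identityʳ 0#) ⟩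
    (1# - μ) * 0#             ≈⟨ zeroʳ (1# - μ) ⟩
    0#                        ∎

  cost⁺-additive : ∀ p q p′ q′ → cost⁺ (p + p′) (q + q′) ≈ cost⁺ p q + cost⁺ p′ q′
  cost⁺-additive = solve 5 (λ u p q p′ q′ → Cost⁺ u (p ⊕ p′) (q ⊕ q′) ⊜ (Cost⁺ u p q ⊕ Cost⁺ u p′ q′)) refl μ

  cost⁻-additive : ∀ p q p′ q′ → cost⁻ (p + p′) (q + q′) ≈ cost⁻ p q + cost⁻ p′ q′
  cost⁻-additive = solve 5 (λ u p q p′ q′ → Cost⁻ u (p ⊕ p′) (q ⊕ q′) ⊜ (Cost⁻ u p q ⊕ Cost⁻ u p′ q′)) refl μ

  c⁺P≈ : c⁺P i ≈ cost⁺ X W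
  c⁺P≈ = begin
    sumL (map c⁺-short (map window ts))  ≡⟨ ≡.cong sumL (map-∘ ts) ⟨
    sumL (map (c⁺-short ∘ window) ts)    ≈⟨ sumL-map-additive cost⁺ cost⁺-zero cost⁺-additive (x ∘ window) onLast ts ⟩
    cost⁺ X W                            ∎

  c⁻P≈ : c⁻P i ≈ cost⁻ X W
  c⁻P≈ = begin
    sumL (map c⁻-short (reverse (map window ts)))  ≡⟨ ≡.cong sumL (reverse-map c⁻-short (map window ts)) ⟩
    sumL (reverse (map c⁻-short (map window ts)))  ≈⟨ sumL-reverse (map c⁻-short (map window ts)) ⟩
    sumL (map c⁻-short (map window ts))            ≡⟨ ≡.cong sumL (map-∘ ts) ⟨
    sumL (map (c⁻-short ∘ window) ts)              ≈⟨ sumL-map-additive cost⁻ cost⁻-zero cost⁻-additive (x ∘ window) onLast ts ⟩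
    cost⁻ X W                                      ∎

  c⁺-gap : c⁺-row i - c⁺P i ≈ - (μ * ι α)
  c⁺-gap = begin
    cost⁺ (Ax i - ι α) (v-row i) - c⁺P i
      ≈⟨ +-cong (*-congˡ (+-cong (+-congʳ Ax≈X) (-‿cong (*-congˡ v-row≈W)))) (-‿cong c⁺P≈) ⟩
    cost⁺ (X - ι α) W - cost⁺ X W
      ≈⟨ scaled-shift μ X (ι α) (- ((1# - μ) * W)) ⟩
    - (μ * ι α) ∎

  c⁻-gap : c⁻-row i - c⁻P i ≈ - ((1# - μ) * ι α)
  c⁻-gap = begin
    cost⁻ (Ax i - ι α) (v-row i) - c⁻P i
      ≈⟨ +-cong (*-congˡ (+-cong (+-congʳ Ax≈X) (*-congˡ v-row≈W))) (-‿cong c⁻P≈) ⟩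
    cost⁻ (X - ι α) W - cost⁻ X W
      ≈⟨ scaled-shift (1# - μ) X (ι α) (μ * W) ⟩
    - ((1# - μ) * ι α) ∎

lemma5p1 : ∀ {c ℓ ℓ' : Level} (R : CommutativeRing c ℓ)
    (_≤R_ : CommutativeRing.Carrier R → CommutativeRing.Carrier R → Set ℓ')
    (ceil : CommutativeRing.Carrier R → CommutativeRing.Carrier R)
    {m n : ℕ} .{{_ : NonZero n}} (A : Circular m n) (α : ℕ)
    (x : Fin n → CommutativeRing.Carrier R) →
    let open CommutativeRing R
        open RingDefs R
        open Costs A α ceil x
    in Feasible _≤R_ →
       ∀ (i : Fin m) →
         (c⁺-row i - c⁺P i ≈ - (μ * ι α))
         × (c⁻-row i - c⁻P i ≈ - ((1# - μ) * ι α))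
lemma5p1 R _ ceil A α x _ i = c⁺-gap , c⁻-gap
  where open RowCosts R ceil A α x i
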